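{- For $n\ge 3$, the complete bipartite graph $K_{n,n}$ satisfies $\mathcal{V}(K_{n,n}) = ((x+1)^n-x^n)^2+2nx^{n+1}+2x^n$, $\mathcal{V}_{\rm o}(K_{n,n}) = ((x+1)^n-x^n)^2+2x^n$, and $\mathcal{V}_{\rm d}(K_{n,n}) = \mathcal{V}_{\rm t}(K_{n,n}) = ((x+1)^n-x^n)^2$.
   Context: For a graph $G$ and $X\subseteq V(G)$, two vertices $x,y$ are $X$-visible if there is a shortest $x,y$-path in $G$ with no internal vertex in $X$. Write $\overline{X}=V(G)\setminus X$. $X$ is a mutual-visibility set if any two vertices of $X$ are $X$-visible; a total mutual-visibility set if any two vertices of $V(G)$ are $X$-visible; a dual mutual-visibility set if any two vertices of $X$ and any two vertices of $\overline{X}$ are $X$-visible; an outer mutual-visibility set if any two vertices of $X$ are $X$-visible and any $x\in X$, $y\in\overline{X}$ are $X$-visible. The visibility polynomial is $\mathcal{V}(G)=\sum_{i\ge0} r_i x^i$, where $r_i$ is the number of mutual-visibility sets of $G$ of cardinality $i$ (the empty set counts, so $r_0=1$). The outer, dual and total visibility polynomials $\mathcal{V}_{\rm o}(G)$, $\mathcal{V}_{\rm d}(G)$, $\mathcal{V}_{\rm t}(G)$ are defined in the same way by counting outer, dual, and total mutual-visibility sets, respectively. -}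

module Defs where

open import Data.Nat as ℕ using (ℕ; zero; suc; _≤_)
open import Data.Integer as ℤ using (ℤ; +_)
open import Data.Fin using (Fin; splitAt)
open import Data.Fin.Subset using (Subset; _∈_; _∉_; ∣_∣)
open import Data.Sum using (_⊎_; inj₁; inj₂)
open import Data.Bool using (Bool; true; false)
open import Data.List using (List; []; _∷_; length)
import Data.List.Membership.Propositional as LM
open import Data.List.Relation.Unary.All using (All)
open import Data.List.Relation.Unary.Unique.Propositional using (Unique)
open import Data.Product using (Σ; ∃; ∃-syntax; _×_; _,_)
open import Relation.Binary.PropositionalEquality using (_≡_; _≢_)
open import Function.Bundles using (_⇔_)

-- Polynomials with integer coefficients, as coefficient functions.

Poly : Set
Poly = ℕ → ℤ

X : Poly
X 1 = + 1
X _ = + 0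

const : ℤ → Poly
const c 0 = c
const c _ = + 0

_+ₚ_ : Poly → Poly → Poly
(p +ₚ q) i = p i ℤ.+ q i

_-ₚ_ : Poly → Poly → Poly
(p -ₚ q) i = p i ℤ.- q i

sumUpTo : ℕ → (ℕ → ℤ) → ℤ
sumUpTo zero f = f 0
sumUpTo (suc k) f = sumUpTo k f ℤ.+ f (suc k)

_*ₚ_ : Poly → Poly → Poly
(p *ₚ q) i = sumUpTo i (λ j → p j ℤ.* q (i ℕ.∸ j))

_^ₚ_ : Poly → ℕ → Poly
p ^ₚ zero = const (+ 1)
p ^ₚ suc k = p *ₚ (p ^ₚ k)

infixl 6 _+ₚ_ _-ₚ_
infixl 7 _*ₚ_
infixr 8 _^ₚ_

record Graph : Set₁ where
  field
    order : ℕ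
    Adj   : Fin order → Fin order → Set

module _ (G : Graph) where
  open Graph G

  data Walk : Fin order → Fin order → Set where
    []  : ∀ {x} → Walk x x
    _∷_ : ∀ {x y z} → Adj x y → Walk y z → Walk x z

  walkLength : ∀ {x y} → Walk x y → ℕ
  walkLength [] = 0
  walkLength (_ ∷ w) = suc (walkLength w)

  inner : ∀ {x y} → Walk x y → List (Fin order)
  inner [] = []
  inner (_ ∷ []) = []
  inner (_∷_ {y = v} _ w@(_ ∷ _)) = v ∷ inner w

  -- a shortest x,y-path (a walk of minimum length, hence a path)
  IsShortest : ∀ {x y} → Walk x y → Set
  IsShortest {x} {y} w = ∀ (w' : Walk x y) → walkLength w ≤ walkLength w'

  Visible : Subset order → Fin order → Fin order → Set
  Visible S x y = ∃[ w ] (IsShortest {x} {y} w × All (λ v → v ∉ S) (inner w))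

  IsMutualVisibility : Subset order → Set
  IsMutualVisibility S = ∀ x y → x ∈ S → y ∈ S → Visible S x y

  IsTotalMutualVisibility : Subset order → Set
  IsTotalMutualVisibility S = ∀ x y → Visible S x y

  IsDualMutualVisibility : Subset order → Set
  IsDualMutualVisibility S =
    (∀ x y → x ∈ S → y ∈ S → Visible S x y) ×
    (∀ x y → x ∉ S → y ∉ S → Visible S x y)

  IsOuterMutualVisibility : Subset order → Set
  IsOuterMutualVisibility S =
    (∀ x y → x ∈ S → y ∈ S → Visible S x y) ×
    (∀ x y → x ∈ S → y ∉ S → Visible S x y)

  HasCount : (Subset order → Set) → ℕ → Set
  HasCount P c = ∃[ xs ] (Unique xs × (∀ S → (S LM.∈ xs) ⇔ P S) × length xs ≡ c)

  CountingPolyIs : (Subset order → Set) → Poly → Set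
  CountingPolyIs P p =
    ∀ i → ∃[ c ] (HasCount (λ S → ∣ S ∣ ≡ i × P S) c × (+ c ≡ p i))

-- Complete bipartite graph K_{n,n}: vertices Fin (n + n); the first n
-- form one side, the last n the other.

side : ∀ {n} → Fin (n ℕ.+ n) → Bool
side {n} v with splitAt n v
... | inj₁ _ = true
... | inj₂ _ = false

K : ℕ → Graph
K n = record { order = n ℕ.+ n ; Adj = λ u v → side {n} u ≢ side {n} v }

-- Split S along the two sides of K_{n,n}. Vertices on different sides are adjacent, and two
-- distinct vertices on the same side are at distance 2, joined through any vertex of the other
-- side; so they are S-visible iff the other side is not contained in S. Each of the four
-- properties is therefore a condition on the shapes of the two halves of S (empty, a
-- singleton, the whole side, or something else); e.g. S is a mutual-visibility set iff no side
-- is whole, or one side is whole and the other has at most one vertex. Dual (by pigeonhole,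
-- n ≥ 3) and total mutual visibility both say that no side is whole. Counted by size, the
-- subsets of one side that are whole, empty, singletons or not whole have generating
-- polynomials x^n, 1, n x and (x+1)^n - x^n, and each visibility polynomial is the
-- corresponding sum of products.

module Submission where

open import Defs
open import Data.Nat as ℕ using (ℕ; zero; suc; _≤_; z≤n; s≤s; _∸_)
import Data.Nat.Properties as ℕₚ
open import Data.Nat.ListAction using (sum)
open import Data.Integer as ℤ using (ℤ; +_)
import Data.Integer.Properties as ℤₚ
open import Data.Integer.Tactic.RingSolver using (solve-∀)
open import Data.Bool as Bool using (Bool; true; false; _∧_; _∨_; not; if_then_else_; T)
open import Data.Bool.Properties using (not-¬; ¬-not; T-∧; T-not-≡; ∨-conicalˡ; ∨-conicalʳ; ∧-zeroʳ; ∧-comm)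
open import Data.Unit using (tt)
open import Data.Empty using (⊥-elim)
open import Data.Product using (∃-syntax; _×_; _,_; proj₁; proj₂)
open import Data.Sum using (inj₁; inj₂)
open import Data.Vec using (Vec; []; _∷_; lookup; take; drop)
import Data.Vec.Properties as Vecₚ
open import Data.Fin as Fin using (Fin; zero; suc; _↑ˡ_; _↑ʳ_; splitAt; join)
import Data.Fin.Properties as Finₚ
open import Data.Fin.Subset using (Subset; _∈_; _∉_; ∣_∣)
open import Data.List using (List; []; _∷_; [_]; length; map; _++_; foldr)
import Data.List.Properties as Listₚ
open import Data.List.Membership.Propositional using () renaming (_∈_ to _∈ₗ_)
open import Data.List.Membership.Propositional.Properties using (∈-map⁺; ∈-map⁻; ∈-++⁺ˡ; ∈-++⁺ʳ; ∈-++⁻)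
open import Data.List.Relation.Unary.Any using (here)
open import Data.List.Relation.Unary.All using ([]; _∷_)
open import Data.List.Relation.Unary.Unique.Propositional using (Unique; []; _∷_)
import Data.List.Relation.Unary.Unique.Propositional.Properties as Uniqueₚ
open import Function using (_∘_; _⇔_; mk⇔; Equivalence)
import Function.Properties.Equivalence as ⇔
open import Data.Product.Function.NonDependent.Propositional using (_×-⇔_)
open import Relation.Nullary using (¬_; yes; no)
open import Relation.Binary.PropositionalEquality hiding ([_])

sumUpTo-cong : ∀ i {f g : ℕ → ℤ} → (∀ {j} → j ≤ i → f j ≡ g j) → sumUpTo i f ≡ sumUpTo i g
sumUpTo-cong zero    f≗g = f≗g z≤n
sumUpTo-cong (suc i) f≗g =
  cong₂ ℤ._+_ (sumUpTo-cong i (f≗g ∘ ℕₚ.m≤n⇒m≤1+n)) (f≗g ℕₚ.≤-refl)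

sumUpTo-+ : ∀ i (f g : ℕ → ℤ) → sumUpTo i (λ j → f j ℤ.+ g j) ≡ sumUpTo i f ℤ.+ sumUpTo i g
sumUpTo-+ zero    f g = refl
sumUpTo-+ (suc i) f g =
  trans (cong (ℤ._+ (f (suc i) ℤ.+ g (suc i))) (sumUpTo-+ i f g))
        (interchange (sumUpTo i f) (sumUpTo i g) (f (suc i)) (g (suc i)))
  where
  interchange : ∀ a b c d → (a ℤ.+ b) ℤ.+ (c ℤ.+ d) ≡ (a ℤ.+ c) ℤ.+ (b ℤ.+ d)
  interchange = solve-∀

sumUpTo-*ˡ : ∀ i c (f : ℕ → ℤ) → sumUpTo i (λ j → c ℤ.* f j) ≡ c ℤ.* sumUpTo i f
sumUpTo-*ˡ zero    c f = refl
sumUpTo-*ˡ (suc i) c f =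
  trans (cong (ℤ._+ c ℤ.* f (suc i)) (sumUpTo-*ˡ i c f))
        (sym (ℤₚ.*-distribˡ-+ c (sumUpTo i f) (f (suc i))))

sumUpTo-suc : ∀ i (f : ℕ → ℤ) → sumUpTo (suc i) f ≡ f 0 ℤ.+ sumUpTo i (f ∘ suc)
sumUpTo-suc zero    f = refl
sumUpTo-suc (suc i) f =
  trans (cong (ℤ._+ f (suc (suc i))) (sumUpTo-suc i f)) (ℤₚ.+-assoc (f 0) _ _)

sumUpTo-zero : ∀ i (f : ℕ → ℤ) → (∀ {j} → j ≤ i → f j ≡ + 0) → sumUpTo i f ≡ + 0
sumUpTo-zero zero    f f≡0 = f≡0 z≤n
sumUpTo-zero (suc i) f f≡0 =
  cong₂ ℤ._+_ (sumUpTo-zero i f (f≡0 ∘ ℕₚ.m≤n⇒m≤1+n)) (f≡0 ℕₚ.≤-refl)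

sumUpTo-single : ∀ i {k} (f : ℕ → ℤ) → k ≤ i → (∀ {j} → j ≤ i → j ≢ k → f j ≡ + 0) →
                 sumUpTo i f ≡ f k
sumUpTo-single zero    f z≤n _ = refl
sumUpTo-single (suc i) {k} f k≤1+i f≡0 with k ℕ.≟ suc i
... | yes refl =
  trans (cong (ℤ._+ f (suc i))
              (sumUpTo-zero i f λ j≤i → f≡0 (ℕₚ.m≤n⇒m≤1+n j≤i) λ { refl → ℕₚ.1+n≰n j≤i }))
        (ℤₚ.+-identityˡ (f (suc i)))
... | no k≢1+i =
  trans (cong₂ ℤ._+_ (sumUpTo-single i f (ℕₚ.≤-pred (ℕₚ.≤∧≢⇒< k≤1+i k≢1+i))
                                      (f≡0 ∘ ℕₚ.m≤n⇒m≤1+n))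
                     (f≡0 ℕₚ.≤-refl (k≢1+i ∘ sym)))
        (ℤₚ.+-identityʳ (f k))

shift : Poly → Poly
shift p zero    = + 0
shift p (suc i) = p i

infixr 8 _·ₚ_
_·ₚ_ : ℤ → Poly → Poly
(c ·ₚ p) i = c ℤ.* p i

shift-cong : ∀ {p q} → p ≗ q → shift p ≗ shift q
shift-cong p≗q zero    = refl
shift-cong p≗q (suc i) = p≗q i

*ₚ-cong : ∀ {p p′ q q′ : Poly} → p ≗ p′ → q ≗ q′ → p *ₚ q ≗ p′ *ₚ q′
*ₚ-cong p≗p′ q≗q′ i = sumUpTo-cong i λ {j} _ → cong₂ ℤ._*_ (p≗p′ j) (q≗q′ (i ∸ j))

*ₚ-distribʳ-+ₚ : ∀ p q r → (p +ₚ q) *ₚ r ≗ p *ₚ r +ₚ q *ₚ r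
*ₚ-distribʳ-+ₚ p q r i =
  trans (sumUpTo-cong i λ {j} _ → ℤₚ.*-distribʳ-+ (r (i ∸ j)) (p j) (q j)) (sumUpTo-+ i _ _)

·ₚ-*ₚ : ∀ c p q → (c ·ₚ p) *ₚ q ≗ c ·ₚ (p *ₚ q)
·ₚ-*ₚ c p q i =
  trans (sumUpTo-cong i λ {j} _ → ℤₚ.*-assoc c (p j) (q (i ∸ j))) (sumUpTo-*ˡ i c _)

*ₚ-·ₚ : ∀ c p q → p *ₚ (c ·ₚ q) ≗ c ·ₚ (p *ₚ q)
*ₚ-·ₚ c p q i =
  trans (sumUpTo-cong i λ {j} _ → swap c (p j) (q (i ∸ j))) (sumUpTo-*ˡ i c _)
  where
  swap : ∀ c a b → a ℤ.* (c ℤ.* b) ≡ c ℤ.* (a ℤ.* b)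
  swap = solve-∀

const-*ₚ : ∀ c p → const c *ₚ p ≗ c ·ₚ p
const-*ₚ c p i = sumUpTo-single i (λ j → const c j ℤ.* p (i ∸ j)) z≤n vanish
  where
  vanish : ∀ {j} → j ≤ i → j ≢ 0 → const c j ℤ.* p (i ∸ j) ≡ + 0
  vanish {zero}  _ j≢0 = ⊥-elim (j≢0 refl)
  vanish {suc j} _ _   = refl

*ₚ-identityˡ : ∀ p → const (+ 1) *ₚ p ≗ p
*ₚ-identityˡ p i = trans (const-*ₚ (+ 1) p i) (ℤₚ.*-identityˡ (p i))

*ₚ-identityʳ : ∀ p → p *ₚ const (+ 1) ≗ p
*ₚ-identityʳ p i =
  trans (sumUpTo-single i (λ j → p j ℤ.* const (+ 1) (i ∸ j)) ℕₚ.≤-refl vanish)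
        (trans (cong (λ k → p i ℤ.* const (+ 1) k) (ℕₚ.n∸n≡0 i)) (ℤₚ.*-identityʳ (p i)))
  where
  vanish : ∀ {j} → j ≤ i → j ≢ i → p j ℤ.* const (+ 1) (i ∸ j) ≡ + 0
  vanish {j} j≤i j≢i with i ∸ j in eq
  ... | zero  = ⊥-elim (j≢i (ℕₚ.≤-antisym j≤i (ℕₚ.m∸n≡0⇒m≤n eq)))
  ... | suc _ = ℤₚ.*-zeroʳ (p j)

shift-*ₚ : ∀ p q → shift p *ₚ q ≗ shift (p *ₚ q)
shift-*ₚ p q zero    = refl
shift-*ₚ p q (suc i) =
  trans (sumUpTo-suc i (λ j → shift p j ℤ.* q (suc i ∸ j))) (ℤₚ.+-identityˡ ((p *ₚ q) i))

*ₚ-shift : ∀ p q → p *ₚ shift q ≗ shift (p *ₚ q)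
*ₚ-shift p q zero    = ℤₚ.*-zeroʳ (p 0)
*ₚ-shift p q (suc i) =
  trans (cong₂ ℤ._+_ (sumUpTo-cong i λ {j} j≤i → cong (λ k → p j ℤ.* shift q k) (ℕₚ.+-∸-assoc 1 j≤i))
                     (trans (cong (λ k → p (suc i) ℤ.* shift q k) (ℕₚ.n∸n≡0 i))
                            (ℤₚ.*-zeroʳ (p (suc i)))))
        (ℤₚ.+-identityʳ ((p *ₚ q) i))

X≗shift-1 : X ≗ shift (const (+ 1))
X≗shift-1 zero          = refl
X≗shift-1 (suc zero)    = refl
X≗shift-1 (suc (suc i)) = refl

X-*ₚ : ∀ p → X *ₚ p ≗ shift p
X-*ₚ p i = trans (*ₚ-cong {q = p} X≗shift-1 (λ _ → refl) i)
                 (trans (shift-*ₚ (const (+ 1)) p i) (shift-cong (*ₚ-identityˡ p) i))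

*ₚ-X : ∀ p → p *ₚ X ≗ shift p
*ₚ-X p i = trans (*ₚ-cong {p = p} (λ _ → refl) X≗shift-1 i)
                 (trans (*ₚ-shift p (const (+ 1)) i) (shift-cong (*ₚ-identityʳ p) i))

𝟙 : Bool → ℕ
𝟙 true  = 1
𝟙 false = 0

-- The coefficient of x^i is the sum of f v over the v with exactly i entries true.
weightPoly : (m : ℕ) → (Vec Bool m → ℕ) → Poly
weightPoly zero    f = const (+ f [])
weightPoly (suc m) f = weightPoly m (f ∘ (false ∷_)) +ₚ shift (weightPoly m (f ∘ (true ∷_)))

weightPoly-cong : ∀ m {f g : Vec Bool m → ℕ} → (∀ v → f v ≡ g v) → weightPoly m f ≗ weightPoly m g
weightPoly-cong zero    f≗g zero    = cong +_ (f≗g [])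
weightPoly-cong zero    f≗g (suc i) = refl
weightPoly-cong (suc m) f≗g i =
  cong₂ ℤ._+_ (weightPoly-cong m (f≗g ∘ (false ∷_)) i)
              (shift-cong (weightPoly-cong m (f≗g ∘ (true ∷_))) i)

weightPoly-+ : ∀ m (f g : Vec Bool m → ℕ) →
               weightPoly m (λ v → f v ℕ.+ g v) ≗ weightPoly m f +ₚ weightPoly m g
weightPoly-+ zero    f g zero    = ℤₚ.pos-+ (f []) (g [])
weightPoly-+ zero    f g (suc i) = refl
weightPoly-+ (suc m) f g i =
  trans (cong₂ ℤ._+_ (weightPoly-+ m _ _ i) (shift-+ i))
        (interchange (weightPoly m (f ∘ (false ∷_)) i) (weightPoly m (g ∘ (false ∷_)) i)
                     (shift (weightPoly m (f ∘ (true ∷_))) i) (shift (weightPoly m (g ∘ (true ∷_))) i))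
  where
  shift-+ : shift (weightPoly m (λ v → f (true ∷ v) ℕ.+ g (true ∷ v)))
            ≗ shift (weightPoly m (f ∘ (true ∷_))) +ₚ shift (weightPoly m (g ∘ (true ∷_)))
  shift-+ zero    = refl
  shift-+ (suc i) = weightPoly-+ m _ _ i
  interchange : ∀ a b c d → (a ℤ.+ b) ℤ.+ (c ℤ.+ d) ≡ (a ℤ.+ c) ℤ.+ (b ℤ.+ d)
  interchange = solve-∀

weightPoly-* : ∀ m c (f : Vec Bool m → ℕ) → weightPoly m (λ v → c ℕ.* f v) ≗ (+ c) ·ₚ weightPoly m f
weightPoly-* zero    c f zero    = ℤₚ.pos-* c (f [])
weightPoly-* zero    c f (suc i) = sym (ℤₚ.*-zeroʳ (+ c))
weightPoly-* (suc m) c f i =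
  trans (cong₂ ℤ._+_ (weightPoly-* m c _ i) (shift-* i))
        (sym (ℤₚ.*-distribˡ-+ (+ c) _ _))
  where
  shift-* : shift (weightPoly m (λ v → c ℕ.* f (true ∷ v))) ≗ (+ c) ·ₚ shift (weightPoly m (f ∘ (true ∷_)))
  shift-* zero    = sym (ℤₚ.*-zeroʳ (+ c))
  shift-* (suc i) = weightPoly-* m c _ i

weightPoly-take-drop : ∀ a b (g : Vec Bool a → ℕ) (h : Vec Bool b → ℕ) →
  weightPoly (a ℕ.+ b) (λ w → g (take a w) ℕ.* h (drop a w)) ≗ weightPoly a g *ₚ weightPoly b h
weightPoly-take-drop zero    b g h i =
  trans (weightPoly-* b (g []) h i) (sym (const-*ₚ (+ g []) (weightPoly b h) i))
weightPoly-take-drop (suc a) b g h i =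
  begin
    weightPoly (a ℕ.+ b) (λ w → g (false ∷ take a w) ℕ.* h (drop a w)) i
      ℤ.+ shift (weightPoly (a ℕ.+ b) (λ w → g (true ∷ take a w) ℕ.* h (drop a w))) i
  ≡⟨ cong₂ ℤ._+_ (weightPoly-take-drop a b _ h i)
                 (shift-cong (weightPoly-take-drop a b _ h) i) ⟩
    (G₀ *ₚ H) i ℤ.+ shift (G₁ *ₚ H) i
  ≡⟨ cong (λ t → (G₀ *ₚ H) i ℤ.+ t) (shift-*ₚ G₁ H i) ⟨
    (G₀ *ₚ H) i ℤ.+ (shift G₁ *ₚ H) i
  ≡⟨ *ₚ-distribʳ-+ₚ G₀ (shift G₁) H i ⟨
    ((G₀ +ₚ shift G₁) *ₚ H) i
  ∎
  where
  open ≡-Reasoning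
  G₀ G₁ H : Poly
  G₀ = weightPoly a (g ∘ (false ∷_))
  G₁ = weightPoly a (g ∘ (true ∷_))
  H  = weightPoly b h

allTrue : ∀ {m} → Vec Bool m → Bool
allTrue []      = true
allTrue (b ∷ v) = b ∧ allTrue v

allFalse : ∀ {m} → Vec Bool m → Bool
allFalse []      = true
allFalse (b ∷ v) = not b ∧ allFalse v

exactlyOne : ∀ {m} → Vec Bool m → Bool
exactlyOne []      = false
exactlyOne (b ∷ v) = if b then allFalse v else exactlyOne v

weightPoly-0 : ∀ m → weightPoly m (λ _ → 0) ≗ λ _ → + 0
weightPoly-0 m = weightPoly-* m 0 (λ _ → 0)

weightPoly-1 : ∀ m → weightPoly m (λ _ → 1) ≗ (X +ₚ const (+ 1)) ^ₚ m
weightPoly-1 zero    zero    = refl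
weightPoly-1 zero    (suc i) = refl
weightPoly-1 (suc m) i =
  begin
    weightPoly m (λ _ → 1) i ℤ.+ shift (weightPoly m (λ _ → 1)) i
  ≡⟨ cong₂ ℤ._+_ (weightPoly-1 m i) (shift-cong (weightPoly-1 m) i) ⟩
    P i ℤ.+ shift P i
  ≡⟨ ℤₚ.+-comm (P i) (shift P i) ⟩
    shift P i ℤ.+ P i
  ≡⟨ cong₂ ℤ._+_ (X-*ₚ P i) (*ₚ-identityˡ P i) ⟨
    (X *ₚ P) i ℤ.+ (const (+ 1) *ₚ P) i
  ≡⟨ *ₚ-distribʳ-+ₚ X (const (+ 1)) P i ⟨
    ((X +ₚ const (+ 1)) *ₚ P) i
  ∎
  where
  open ≡-Reasoning
  P : Poly
  P = (X +ₚ const (+ 1)) ^ₚ m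

weightPoly-allTrue : ∀ m → weightPoly m (𝟙 ∘ allTrue) ≗ X ^ₚ m
weightPoly-allTrue zero    zero    = refl
weightPoly-allTrue zero    (suc i) = refl
weightPoly-allTrue (suc m) i =
  trans (cong₂ ℤ._+_ (weightPoly-0 m i) (shift-cong (weightPoly-allTrue m) i))
        (trans (ℤₚ.+-identityˡ _) (sym (X-*ₚ (X ^ₚ m) i)))

weightPoly-allFalse : ∀ m → weightPoly m (𝟙 ∘ allFalse) ≗ const (+ 1)
weightPoly-allFalse zero    zero    = refl
weightPoly-allFalse zero    (suc i) = refl
weightPoly-allFalse (suc m) zero    = trans (ℤₚ.+-identityʳ _) (weightPoly-allFalse m zero)
weightPoly-allFalse (suc m) (suc i) =
  cong₂ ℤ._+_ (weightPoly-allFalse m (suc i)) (weightPoly-0 m i)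

weightPoly-exactlyOne : ∀ m → weightPoly m (𝟙 ∘ exactlyOne) ≗ (+ m) ·ₚ X
weightPoly-exactlyOne zero    zero    = refl
weightPoly-exactlyOne zero    (suc i) = refl
weightPoly-exactlyOne (suc m) i =
  trans (cong₂ ℤ._+_ (weightPoly-exactlyOne m i)
                     (trans (shift-cong (weightPoly-allFalse m) i) (sym (X≗shift-1 i))))
        (collect (+ m) (X i))
  where
  collect : ∀ k x → k ℤ.* x ℤ.+ x ≡ (+ 1 ℤ.+ k) ℤ.* x
  collect = solve-∀

weightPoly-notAllTrue : ∀ m →
  weightPoly m (𝟙 ∘ not ∘ allTrue) ≗ (X +ₚ const (+ 1)) ^ₚ m -ₚ X ^ₚ m
weightPoly-notAllTrue m i =
  begin
    F i
  ≡⟨ cancel (F i) (G i) ⟨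
    (F i ℤ.+ G i) ℤ.- G i
  ≡⟨ cong₂ ℤ._-_ (sym (weightPoly-+ m _ _ i)) (weightPoly-allTrue m i) ⟩
    weightPoly m (λ v → 𝟙 (not (allTrue v)) ℕ.+ 𝟙 (allTrue v)) i ℤ.- (X ^ₚ m) i
  ≡⟨ cong (ℤ._- (X ^ₚ m) i) (trans (weightPoly-cong m (complement ∘ allTrue) i) (weightPoly-1 m i)) ⟩
    ((X +ₚ const (+ 1)) ^ₚ m) i ℤ.- (X ^ₚ m) i
  ∎
  where
  open ≡-Reasoning
  F G : Poly
  F = weightPoly m (𝟙 ∘ not ∘ allTrue)
  G = weightPoly m (𝟙 ∘ allTrue)
  cancel : ∀ a b → (a ℤ.+ b) ℤ.- b ≡ a
  cancel = solve-∀
  complement : ∀ b → 𝟙 (not b) ℕ.+ 𝟙 b ≡ 1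
  complement true  = refl
  complement false = refl

layer : (m : ℕ) → (Vec Bool m → Bool) → ℕ → List (Vec Bool m)
layer zero    F zero    with F []
... | true  = [ [] ]
... | false = []
layer zero    F (suc i) = []
layer (suc m) F zero    = map (false ∷_) (layer m (F ∘ (false ∷_)) zero)
layer (suc m) F (suc i) = map (false ∷_) (layer m (F ∘ (false ∷_)) (suc i))
                       ++ map (true ∷_) (layer m (F ∘ (true ∷_)) i)

length-layer : ∀ m F i → + length (layer m F i) ≡ weightPoly m (𝟙 ∘ F) i
length-layer zero    F zero    with F []
... | true  = refl
... | false = refl
length-layer zero    F (suc i) = refl
length-layer (suc m) F zero    =
  trans (cong +_ (Listₚ.length-map (false ∷_) (layer m _ zero)))
        (trans (length-layer m _ zero) (sym (ℤₚ.+-identityʳ _)))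
length-layer (suc m) F (suc i) =
  trans (cong +_ (trans (Listₚ.length-++ (map (false ∷_) (layer m _ (suc i))))
                        (cong₂ ℕ._+_ (Listₚ.length-map (false ∷_) (layer m _ (suc i)))
                                     (Listₚ.length-map (true ∷_) (layer m _ i)))))
        (trans (ℤₚ.pos-+ (length (layer m _ (suc i))) (length (layer m (F ∘ (true ∷_)) i)))
               (cong₂ ℤ._+_ (length-layer m _ (suc i)) (length-layer m _ i)))

∈-layer⁻ : ∀ m F i {v} → v ∈ₗ layer m F i → ∣ v ∣ ≡ i × T (F v)
∈-layer⁻ zero    F zero    {[]} v∈ with F []
... | true  = refl , tt
∈-layer⁻ (suc m) F zero    v∈ with ∈-map⁻ (false ∷_) v∈
... | _ , v∈′ , refl = ∈-layer⁻ m _ zero v∈′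
∈-layer⁻ (suc m) F (suc i) v∈ with ∈-++⁻ (map (false ∷_) (layer m _ (suc i))) v∈
... | inj₁ v∈₀ with ∈-map⁻ (false ∷_) v∈₀
...   | _ , v∈′ , refl = ∈-layer⁻ m _ (suc i) v∈′
∈-layer⁻ (suc m) F (suc i) v∈ | inj₂ v∈₁ with ∈-map⁻ (true ∷_) v∈₁
...   | _ , v∈′ , refl with ∈-layer⁻ m _ i v∈′
...     | ∣v∣≡i , Fv = cong suc ∣v∣≡i , Fv

∈-layer⁺ : ∀ m F i {v} → ∣ v ∣ ≡ i → T (F v) → v ∈ₗ layer m F i
∈-layer⁺ zero    F zero    {[]} _ Fv with F []
... | true  = here refl
∈-layer⁺ (suc m) F zero    {false ∷ v} ∣v∣≡0 Fv = ∈-map⁺ (false ∷_) (∈-layer⁺ m _ zero ∣v∣≡0 Fv)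
∈-layer⁺ (suc m) F (suc i) {false ∷ v} ∣v∣≡i Fv =
  ∈-++⁺ˡ (∈-map⁺ (false ∷_) (∈-layer⁺ m _ (suc i) ∣v∣≡i Fv))
∈-layer⁺ (suc m) F (suc i) {true ∷ v}  ∣v∣≡i Fv =
  ∈-++⁺ʳ (map (false ∷_) (layer m _ (suc i)))
         (∈-map⁺ (true ∷_) (∈-layer⁺ m _ i (ℕₚ.suc-injective ∣v∣≡i) Fv))

layer-unique : ∀ m F i → Unique (layer m F i)
layer-unique zero    F zero    with F []
... | true  = [] ∷ []
... | false = []
layer-unique zero    F (suc i) = []
layer-unique (suc m) F zero    = Uniqueₚ.map⁺ Vecₚ.∷-injectiveʳ (layer-unique m _ zero)
layer-unique (suc m) F (suc i) =
  Uniqueₚ.++⁺ (Uniqueₚ.map⁺ Vecₚ.∷-injectiveʳ (layer-unique m _ (suc i)))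
              (Uniqueₚ.map⁺ Vecₚ.∷-injectiveʳ (layer-unique m _ i))
              disjoint
  where
  disjoint : ∀ {v} → ¬ (v ∈ₗ map (false ∷_) (layer m _ (suc i)) × v ∈ₗ map (true ∷_) (layer m _ i))
  disjoint (v∈₀ , v∈₁) with ∈-map⁻ (false ∷_) v∈₀ | ∈-map⁻ (true ∷_) v∈₁
  ... | _ , _ , refl | _ , _ , ()

countingPolyIs : ∀ G {P} (F : Subset (Graph.order G) → Bool) {p} →
                 (∀ S → P S ⇔ T (F S)) → weightPoly (Graph.order G) (𝟙 ∘ F) ≗ p →
                 CountingPolyIs G P p
countingPolyIs G {P} F P⇔F F≗p i =
  length (layer _ F i) ,
  (layer _ F i , layer-unique _ F i , ∈⇔ , refl) ,
  trans (length-layer _ F i) (F≗p i)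
  where
  ∈⇔ : ∀ S → S ∈ₗ layer _ F i ⇔ (∣ S ∣ ≡ i × P S)
  ∈⇔ S = mk⇔ (λ S∈ → let ∣S∣≡i , FS = ∈-layer⁻ _ F i S∈ in ∣S∣≡i , Equivalence.from (P⇔F S) FS)
             (λ (∣S∣≡i , PS) → ∈-layer⁺ _ F i ∣S∣≡i (Equivalence.to (P⇔F S) PS))

allTrue≡false⇔ : ∀ {m} (v : Vec Bool m) → allTrue v ≡ false ⇔ (∃[ a ] lookup v a ≡ false)
allTrue≡false⇔ v = mk⇔ (to v) (λ (a , va≡false) → from v a va≡false)
  where
  to : ∀ {m} (v : Vec Bool m) → allTrue v ≡ false → ∃[ a ] lookup v a ≡ false
  to (false ∷ v) _ = zero , refl
  to (true  ∷ v) eq with to v eq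
  ... | a , va≡false = suc a , va≡false
  from : ∀ {m} (v : Vec Bool m) a → lookup v a ≡ false → allTrue v ≡ false
  from (false ∷ v) _       _  = refl
  from (true  ∷ v) (suc a) eq = from v a eq

allFalse≡false⇔ : ∀ {m} (v : Vec Bool m) → allFalse v ≡ false ⇔ (∃[ a ] lookup v a ≡ true)
allFalse≡false⇔ v = mk⇔ (to v) (λ (a , va≡true) → from v a va≡true)
  where
  to : ∀ {m} (v : Vec Bool m) → allFalse v ≡ false → ∃[ a ] lookup v a ≡ true
  to (true  ∷ v) _ = zero , refl
  to (false ∷ v) eq with to v eq
  ... | a , va≡true = suc a , va≡true
  from : ∀ {m} (v : Vec Bool m) a → lookup v a ≡ true → allFalse v ≡ false
  from (true  ∷ v) _       _  = refl
  from (false ∷ v) (suc a) eq = from v a eq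

atMostOneTrue : ∀ {m} → Vec Bool m → Bool
atMostOneTrue v = allFalse v ∨ exactlyOne v

TwoTrue : ∀ {m} → Vec Bool m → Set
TwoTrue v = ∃[ a ] ∃[ a′ ] (a ≢ a′ × lookup v a ≡ true × lookup v a′ ≡ true)

atMostOneTrue≡false⇔ : ∀ {m} (v : Vec Bool m) → atMostOneTrue v ≡ false ⇔ TwoTrue v
atMostOneTrue≡false⇔ v = mk⇔ (to v) (λ (a , a′ , a≢a′ , va , va′) → from v a a′ a≢a′ va va′)
  where
  to : ∀ {m} (v : Vec Bool m) → atMostOneTrue v ≡ false → TwoTrue v
  to (true ∷ v) eq with Equivalence.to (allFalse≡false⇔ v) eq
  ... | a , va = zero , suc a , (λ ()) , refl , va
  to (false ∷ v) eq with to v eq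
  ... | a , a′ , a≢a′ , va , va′ = suc a , suc a′ , a≢a′ ∘ Finₚ.suc-injective , va , va′
  from : ∀ {m} (v : Vec Bool m) a a′ → a ≢ a′ → lookup v a ≡ true → lookup v a′ ≡ true →
         atMostOneTrue v ≡ false
  from (b ∷ v)     zero    zero    a≢a′ _  _   = ⊥-elim (a≢a′ refl)
  from (true ∷ v)  zero    (suc a′) _   _  va′ = Equivalence.from (allFalse≡false⇔ v) (a′ , va′)
  from (true ∷ v)  (suc a) _        _   va _   = Equivalence.from (allFalse≡false⇔ v) (a , va)
  from (false ∷ v) (suc a) (suc a′) a≢a′ va va′ = from v a a′ (a≢a′ ∘ cong suc) va va′

pigeonhole : ∀ {m} → 3 ≤ m → (v : Vec Bool m) → ∃[ a ] ∃[ a′ ] (a ≢ a′ × lookup v a ≡ lookup v a′)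
pigeonhole (s≤s (s≤s (s≤s _))) (false ∷ false ∷ _     ∷ _) = zero , suc zero , (λ ()) , refl
pigeonhole (s≤s (s≤s (s≤s _))) (true  ∷ true  ∷ _     ∷ _) = zero , suc zero , (λ ()) , refl
pigeonhole (s≤s (s≤s (s≤s _))) (false ∷ true  ∷ false ∷ _) = zero , suc (suc zero) , (λ ()) , refl
pigeonhole (s≤s (s≤s (s≤s _))) (true  ∷ false ∷ true  ∷ _) = zero , suc (suc zero) , (λ ()) , refl
pigeonhole (s≤s (s≤s (s≤s _))) (false ∷ true  ∷ true  ∷ _) = suc zero , suc (suc zero) , (λ ()) , refl
pigeonhole (s≤s (s≤s (s≤s _))) (true  ∷ false ∷ false ∷ _) = suc zero , suc (suc zero) , (λ ()) , refl

lookup-take : ∀ {A : Set} m {k} (xs : Vec A (m ℕ.+ k)) i → lookup (take m xs) i ≡ lookup xs (i ↑ˡ k)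
lookup-take (suc m) (x ∷ xs) zero    = refl
lookup-take (suc m) (x ∷ xs) (suc i) = lookup-take m xs i

lookup-drop : ∀ {A : Set} m {k} (xs : Vec A (m ℕ.+ k)) i → lookup (drop m xs) i ≡ lookup xs (m ↑ʳ i)
lookup-drop zero    xs       i = refl
lookup-drop (suc m) (x ∷ xs) i = lookup-drop m xs i

∈⇔lookup≡true : ∀ {m} (S : Subset m) x → x ∈ S ⇔ lookup S x ≡ true
∈⇔lookup≡true S x = mk⇔ Vecₚ.[]=⇒lookup (Vecₚ.lookup⇒[]= x S)

∉⇔lookup≡false : ∀ {m} (S : Subset m) x → x ∉ S ⇔ lookup S x ≡ false
∉⇔lookup≡false S x = mk⇔ to from
  where
  to : x ∉ S → lookup S x ≡ false
  to x∉S with lookup S x in eq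
  ... | true  = ⊥-elim (x∉S (Vecₚ.lookup⇒[]= x S eq))
  ... | false = refl
  from : lookup S x ≡ false → x ∉ S
  from Sx≡false x∈S with trans (sym Sx≡false) (Vecₚ.[]=⇒lookup x∈S)
  ... | ()

T-∨-not : ∀ {b c} → (b ≡ false → c ≡ false) → T (b ∨ not c)
T-∨-not {true}          _       = tt
T-∨-not {false} {false} _       = tt
T-∨-not {false} {true}  b⇒c with b⇒c refl
... | ()

T-∨-not⁻ : ∀ {b c} → T (b ∨ not c) → b ≡ false → c ≡ false
T-∨-not⁻ {false} {false} _ _ = refl

module _ {n : ℕ} where

  vertex : Bool → Fin n → Fin (n ℕ.+ n)
  vertex true  a = a ↑ˡ n
  vertex false a = n ↑ʳ a

  part : Bool → Subset (n ℕ.+ n) → Vec Bool n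
  part true  = take n
  part false = drop n

  side-vertex : ∀ s a → side {n} (vertex s a) ≡ s
  side-vertex true  a rewrite Finₚ.splitAt-↑ˡ n a n = refl
  side-vertex false a rewrite Finₚ.splitAt-↑ʳ n n a = refl

  vertex-injective : ∀ s {a a′} → vertex s a ≡ vertex s a′ → a ≡ a′
  vertex-injective true  = Finₚ.↑ˡ-injective n _ _
  vertex-injective false = Finₚ.↑ʳ-injective n _ _

  lookup-part : ∀ s S a → lookup (part s S) a ≡ lookup S (vertex s a)
  lookup-part true  S a = lookup-take n S a
  lookup-part false S a = lookup-drop n S a

  data VertexView : Fin (n ℕ.+ n) → Set where
    at : ∀ s a → VertexView (vertex s a)

  vertexView : ∀ x → VertexView x
  vertexView x = subst VertexView (Finₚ.join-splitAt n n x) (fromSplit (splitAt n x))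
    where
    fromSplit : ∀ y → VertexView (join n n y)
    fromSplit (inj₁ a) = at true a
    fromSplit (inj₂ b) = at false b

  private
    sideOf : Fin (n ℕ.+ n) → Bool
    sideOf = side {n}

  visible-refl : ∀ S x → Visible (K n) S x x
  visible-refl S x = [] , (λ _ → z≤n) , []

  visible-adjacent : ∀ S {x y} → sideOf x ≢ sideOf y → Visible (K n) S x y
  visible-adjacent S x≁y = x≁y ∷ [] , shortest , []
    where
    shortest : ∀ w → 1 ≤ walkLength (K n) w
    shortest []      = ⊥-elim (x≁y refl)
    shortest (_ ∷ _) = s≤s z≤n

  visible-through : ∀ S {x y z} → x ≢ y → sideOf x ≡ sideOf y → sideOf z ≢ sideOf x → z ∉ S →
                    Visible (K n) S x y
  visible-through S x≢y x∼y z≁x z∉S =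
    (z≁x ∘ sym) ∷ (z≁x ∘ λ z∼y → trans z∼y (sym x∼y)) ∷ [] , shortest , z∉S ∷ []
    where
    shortest : ∀ w → 2 ≤ walkLength (K n) w
    shortest []            = ⊥-elim (x≢y refl)
    shortest (x≁y ∷ [])    = ⊥-elim (x≁y x∼y)
    shortest (_ ∷ _ ∷ _)   = s≤s (s≤s z≤n)

  -- u yields a path of length 2, so a shortest path has exactly one internal vertex.
  visible⇒outside : ∀ S {x y} u → x ≢ y → sideOf x ≡ sideOf y → sideOf u ≢ sideOf x →
                    Visible (K n) S x y → ∃[ z ] (sideOf z ≢ sideOf x × z ∉ S)
  visible⇒outside S u x≢y x∼y u≁x ([] , _ , _)                      = ⊥-elim (x≢y refl)
  visible⇒outside S u x≢y x∼y u≁x (x≁y ∷ [] , _ , _)                = ⊥-elim (x≁y x∼y)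
  visible⇒outside S u x≢y x∼y u≁x (_∷_ {y = z} x≁z (_ ∷ []) , _ , z∉S ∷ []) = z , x≁z ∘ sym , z∉S
  visible⇒outside S u x≢y x∼y u≁x (_ ∷ _ ∷ _ ∷ _ , shortest , _)
    with shortest ((u≁x ∘ sym) ∷ (u≁x ∘ λ u∼y → trans u∼y (sym x∼y)) ∷ [])
  ... | s≤s (s≤s ())

  vertex∈⇔ : ∀ S s a → vertex s a ∈ S ⇔ lookup (part s S) a ≡ true
  vertex∈⇔ S s a rewrite lookup-part s S a = ∈⇔lookup≡true S (vertex s a)

  vertex∉⇔ : ∀ S s a → vertex s a ∉ S ⇔ lookup (part s S) a ≡ false
  vertex∉⇔ S s a rewrite lookup-part s S a = ∉⇔lookup≡false S (vertex s a)

  sameSide-visible⇔ : ∀ S s {a a′} → a ≢ a′ →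
                      Visible (K n) S (vertex s a) (vertex s a′) ⇔ allTrue (part (not s) S) ≡ false
  sameSide-visible⇔ S s {a} {a′} a≢a′ = mk⇔ to from
    where
    distinct : vertex s a ≢ vertex s a′
    distinct = a≢a′ ∘ vertex-injective s
    sameSide : sideOf (vertex s a) ≡ sideOf (vertex s a′)
    sameSide = trans (side-vertex s a) (sym (side-vertex s a′))
    opposite : ∀ b → sideOf (vertex (not s) b) ≢ sideOf (vertex s a)
    opposite b eq = not-¬ refl (trans (sym (side-vertex s a)) (trans (sym eq) (side-vertex (not s) b)))
    to : Visible (K n) S (vertex s a) (vertex s a′) → allTrue (part (not s) S) ≡ false
    to vis with visible⇒outside S (vertex (not s) a) distinct sameSide (opposite a) vis
    ... | z , z≁x , z∉S with vertexView z
    ...   | at t b with ¬-not (λ t≡s → z≁x (trans (side-vertex t b) (trans t≡s (sym (side-vertex s a)))))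
    ...     | refl = Equivalence.from (allTrue≡false⇔ (part (not s) S))
                                      (b , Equivalence.to (vertex∉⇔ S (not s) b) z∉S)
    from : allTrue (part (not s) S) ≡ false → Visible (K n) S (vertex s a) (vertex s a′)
    from gap with Equivalence.to (allTrue≡false⇔ (part (not s) S)) gap
    ... | b , b∉ =
      visible-through S distinct sameSide (opposite b) (Equivalence.from (vertex∉⇔ S (not s) b) b∉)

  visible-unlessBlocked : ∀ S s t a b → (s ≡ t → a ≢ b → allTrue (part (not s) S) ≡ false) →
                          Visible (K n) S (vertex s a) (vertex t b)
  visible-unlessBlocked S s t a b unblocked with s Bool.≟ t
  ... | no s≢t = visible-adjacent S λ eq → s≢t (trans (sym (side-vertex s a)) (trans eq (side-vertex t b)))
  ... | yes refl with a Fin.≟ b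
  ...   | yes refl = visible-refl S (vertex s a)
  ...   | no a≢b   = Equivalence.from (sameSide-visible⇔ S s a≢b) (unblocked refl a≢b)


  -- In c v u, v is the part of S on one side and u the part on the other side.
  bothSides : (Vec Bool n → Vec Bool n → Bool) → Subset (n ℕ.+ n) → Bool
  bothSides c S = c (part true S) (part false S) ∧ c (part false S) (part true S)

  OnEachSide : (Vec Bool n → Vec Bool n → Bool) → Subset (n ℕ.+ n) → Set
  OnEachSide c S = ∀ s → T (c (part s S) (part (not s) S))

  bothSides⇔ : ∀ c S → T (bothSides c S) ⇔ OnEachSide c S
  bothSides⇔ c S = mk⇔ (λ both → λ { true → proj₁ (Equivalence.to T-∧ both)
                                   ; false → proj₂ (Equivalence.to T-∧ both) })
                       (λ each → Equivalence.from T-∧ (each true , each false))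

  mvCondition : Vec Bool n → Vec Bool n → Bool
  mvCondition v u = atMostOneTrue v ∨ not (allTrue u)

  mixedCondition : Vec Bool n → Vec Bool n → Bool
  mixedCondition v u = (allTrue v ∨ allFalse v) ∨ not (allTrue u)

  totalCondition : Vec Bool n → Vec Bool n → Bool
  totalCondition _ u = not (allTrue u)

  mutualVisibility⇔ : ∀ S → IsMutualVisibility (K n) S ⇔ OnEachSide mvCondition S
  mutualVisibility⇔ S = mk⇔ to from
    where
    to : IsMutualVisibility (K n) S → OnEachSide mvCondition S
    to mv s = T-∨-not λ twoOrMore →
      let a , a′ , a≢a′ , a∈ , a′∈ = Equivalence.to (atMostOneTrue≡false⇔ (part s S)) twoOrMore
      in Equivalence.to (sameSide-visible⇔ S s a≢a′)
           (mv _ _ (Equivalence.from (vertex∈⇔ S s a) a∈) (Equivalence.from (vertex∈⇔ S s a′) a′∈))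
    from : OnEachSide mvCondition S → IsMutualVisibility (K n) S
    from sides x y x∈S y∈S with vertexView x | vertexView y
    ... | at s a | at t b = visible-unlessBlocked S s t a b λ { refl a≢b →
      T-∨-not⁻ (sides s) (Equivalence.from (atMostOneTrue≡false⇔ (part s S))
        (a , b , a≢b , Equivalence.to (vertex∈⇔ S s a) x∈S , Equivalence.to (vertex∈⇔ S s b) y∈S)) }

  mixedVisible⇔ : ∀ S → (∀ x y → x ∈ S → y ∉ S → Visible (K n) S x y)
                                ⇔ OnEachSide mixedCondition S
  mixedVisible⇔ S = mk⇔ to from
    where
    to : (∀ x y → x ∈ S → y ∉ S → Visible (K n) S x y) → OnEachSide mixedCondition S
    to mixed s = T-∨-not λ neither →
      blocked (Equivalence.to (allTrue≡false⇔ (part s S)) (∨-conicalˡ _ _ neither))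
              (Equivalence.to (allFalse≡false⇔ (part s S)) (∨-conicalʳ _ _ neither))
      where
      blocked : ∃[ a ] lookup (part s S) a ≡ false → ∃[ a ] lookup (part s S) a ≡ true →
                allTrue (part (not s) S) ≡ false
      blocked (a , a∉) (a′ , a′∈) = Equivalence.to (sameSide-visible⇔ S s a′≢a)
        (mixed _ _ (Equivalence.from (vertex∈⇔ S s a′) a′∈) (Equivalence.from (vertex∉⇔ S s a) a∉))
        where
        a′≢a : a′ ≢ a
        a′≢a refl with trans (sym a∉) a′∈
        ... | ()
    from : OnEachSide mixedCondition S → ∀ x y → x ∈ S → y ∉ S → Visible (K n) S x y
    from sides x y x∈S y∉S with vertexView x | vertexView y
    ... | at s a | at t b = visible-unlessBlocked S s t a b λ { refl _ →
      T-∨-not⁻ (sides s)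
        (cong₂ _∨_ (Equivalence.from (allTrue≡false⇔ (part s S)) (b , Equivalence.to (vertex∉⇔ S s b) y∉S))
                   (Equivalence.from (allFalse≡false⇔ (part s S)) (a , Equivalence.to (vertex∈⇔ S s a) x∈S))) }

  outerCondition : Vec Bool n → Vec Bool n → Bool
  outerCondition v u = mvCondition v u ∧ mixedCondition v u

  OnEachSide-∧ : ∀ c d S → OnEachSide (λ v u → c v u ∧ d v u) S ⇔ (OnEachSide c S × OnEachSide d S)
  OnEachSide-∧ c d S = mk⇔ (λ both → proj₁ ∘ Equivalence.to T-∧ ∘ both , proj₂ ∘ Equivalence.to T-∧ ∘ both)
                           (λ (each₁ , each₂) s → Equivalence.from T-∧ (each₁ s , each₂ s))

  outerMutualVisibility⇔ : ∀ S → IsOuterMutualVisibility (K n) S ⇔ OnEachSide outerCondition S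
  outerMutualVisibility⇔ S =
    ⇔.trans (mutualVisibility⇔ S ×-⇔ mixedVisible⇔ S) (⇔.sym (OnEachSide-∧ mvCondition mixedCondition S))

  visibleWhenUnblocked : ∀ S → OnEachSide totalCondition S → ∀ x y → Visible (K n) S x y
  visibleWhenUnblocked S sides x y with vertexView x | vertexView y
  ... | at s a | at t b = visible-unlessBlocked S s t a b λ { refl _ → Equivalence.to T-not-≡ (sides s) }

  totalMutualVisibility⇔ : 2 ≤ n → ∀ S → IsTotalMutualVisibility (K n) S ⇔ OnEachSide totalCondition S
  totalMutualVisibility⇔ (s≤s (s≤s _)) S = mk⇔ to (visibleWhenUnblocked S)
    where
    to : IsTotalMutualVisibility (K n) S → OnEachSide totalCondition S
    to total s = Equivalence.from T-not-≡
      (Equivalence.to (sameSide-visible⇔ S s {zero} {suc zero} (λ ())) (total _ _))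

  dualMutualVisibility⇔ : 3 ≤ n → ∀ S → IsDualMutualVisibility (K n) S ⇔ OnEachSide totalCondition S
  dualMutualVisibility⇔ 3≤n S = mk⇔ to (λ sides → (λ x y _ _ → visibleWhenUnblocked S sides x y)
                                                , (λ x y _ _ → visibleWhenUnblocked S sides x y))
    where
    to : IsDualMutualVisibility (K n) S → OnEachSide totalCondition S
    to (inside , outside) s with pigeonhole 3≤n (part s S)
    ... | a , a′ , a≢a′ , same = Equivalence.from T-not-≡
      (Equivalence.to (sameSide-visible⇔ S s a≢a′) (visiblePair (lookup (part s S) a) refl same))
      where
      visiblePair : ∀ b → lookup (part s S) a ≡ b → b ≡ lookup (part s S) a′ →
                    Visible (K n) S (vertex s a) (vertex s a′)
      visiblePair true  a∈ a′∈ =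
        inside _ _ (Equivalence.from (vertex∈⇔ S s a) a∈) (Equivalence.from (vertex∈⇔ S s a′) (sym a′∈))
      visiblePair false a∉ a′∉ =
        outside _ _ (Equivalence.from (vertex∉⇔ S s a) a∉) (Equivalence.from (vertex∉⇔ S s a′) (sym a′∉))

data Shape : Set where
  empty singleton full other : Shape

-- On vectors of length < 2 the cases overlap; they are resolved in the order full, empty, singleton.
shapeOf : (all none one : Bool) → Shape
shapeOf true  _     _     = full
shapeOf false true  _     = empty
shapeOf false false true  = singleton
shapeOf false false false = other

shape : ∀ {m} → Vec Bool m → Shape
shape v = shapeOf (allTrue v) (allFalse v) (exactlyOne v)

isEmpty isSingleton isFull : Shape → Bool
isEmpty empty = true
isEmpty _     = false
isSingleton singleton = true
isSingleton _         = false
isFull full = true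
isFull _    = false

notFull : Shape → Bool
notFull = not ∘ isFull

allTrue∧allFalse : ∀ {m} (v : Vec Bool (suc m)) → allTrue v ∧ allFalse v ≡ false
allTrue∧allFalse (false ∷ v) = refl
allTrue∧allFalse (true  ∷ v) = ∧-zeroʳ (allTrue v)

allTrue∧exactlyOne : ∀ {m} (v : Vec Bool (suc (suc m))) → allTrue v ∧ exactlyOne v ≡ false
allTrue∧exactlyOne (false ∷ v)     = refl
allTrue∧exactlyOne (true ∷ false ∷ v) = refl
allTrue∧exactlyOne (true ∷ true ∷ v)  = ∧-zeroʳ (allTrue v)

allFalse∧exactlyOne : ∀ {m} (v : Vec Bool m) → allFalse v ∧ exactlyOne v ≡ false
allFalse∧exactlyOne []          = refl
allFalse∧exactlyOne (true  ∷ v) = refl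
allFalse∧exactlyOne (false ∷ v) = allFalse∧exactlyOne v

isFull-shapeOf : ∀ a e o → isFull (shapeOf a e o) ≡ a
isFull-shapeOf true  _     _     = refl
isFull-shapeOf false true  _     = refl
isFull-shapeOf false false true  = refl
isFull-shapeOf false false false = refl

isEmpty-shapeOf : ∀ a e o → a ∧ e ≡ false → isEmpty (shapeOf a e o) ≡ e
isEmpty-shapeOf true  false _     _ = refl
isEmpty-shapeOf false true  _     _ = refl
isEmpty-shapeOf false false true  _ = refl
isEmpty-shapeOf false false false _ = refl

isSingleton-shapeOf : ∀ a e o → a ∧ o ≡ false → e ∧ o ≡ false → isSingleton (shapeOf a e o) ≡ o
isSingleton-shapeOf true  _     false _ _ = refl
isSingleton-shapeOf false true  false _ _ = refl
isSingleton-shapeOf false false true  _ _ = refl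
isSingleton-shapeOf false false false _ _ = refl

isFull-shape : ∀ {m} (v : Vec Bool m) → isFull (shape v) ≡ allTrue v
isFull-shape v = isFull-shapeOf (allTrue v) (allFalse v) (exactlyOne v)

isEmpty-shape : ∀ {m} (v : Vec Bool (suc m)) → isEmpty (shape v) ≡ allFalse v
isEmpty-shape v = isEmpty-shapeOf (allTrue v) (allFalse v) (exactlyOne v) (allTrue∧allFalse v)

isSingleton-shape : ∀ {m} (v : Vec Bool (suc (suc m))) → isSingleton (shape v) ≡ exactlyOne v
isSingleton-shape v =
  isSingleton-shapeOf (allTrue v) (allFalse v) (exactlyOne v) (allTrue∧exactlyOne v) (allFalse∧exactlyOne v)

shapePoly : (m : ℕ) → (Shape → Bool) → Poly
shapePoly m P = weightPoly m (𝟙 ∘ P ∘ shape)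

Σₚ : List Poly → Poly
Σₚ = foldr _+ₚ_ (λ _ → + 0)

ShapeTerms : Set
ShapeTerms = List ((Shape → Bool) × (Shape → Bool))

termCount : ShapeTerms → Shape → Shape → ℕ
termCount ts c d = sum (map (λ (P , Q) → 𝟙 (P c ∧ Q d)) ts)

termPoly : ℕ → ShapeTerms → Poly
termPoly n ts = Σₚ (map (λ (P , Q) → shapePoly n P *ₚ shapePoly n Q) ts)

𝟙-∧ : ∀ x y → 𝟙 (x ∧ y) ≡ 𝟙 x ℕ.* 𝟙 y
𝟙-∧ true  y = sym (ℕₚ.*-identityˡ (𝟙 y))
𝟙-∧ false y = refl

weightPoly-termCount : ∀ n ts →
  weightPoly (n ℕ.+ n) (λ S → termCount ts (shape (take n S)) (shape (drop n S))) ≗ termPoly n ts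
weightPoly-termCount n []             = weightPoly-0 (n ℕ.+ n)
weightPoly-termCount n ((P , Q) ∷ ts) i =
  trans (weightPoly-+ (n ℕ.+ n) _ _ i)
        (cong₂ ℤ._+_ (trans (weightPoly-cong (n ℕ.+ n) (λ S → 𝟙-∧ (P (shape (take n S))) (Q (shape (drop n S))))
                                             i)
                            (weightPoly-take-drop n n _ _ i))
                     (weightPoly-termCount n ts i))

shapePoly-full : ∀ m → shapePoly m isFull ≗ X ^ₚ m
shapePoly-full m i = trans (weightPoly-cong m (cong 𝟙 ∘ isFull-shape) i) (weightPoly-allTrue m i)

shapePoly-notFull : ∀ m → shapePoly m notFull ≗ (X +ₚ const (+ 1)) ^ₚ m -ₚ X ^ₚ m
shapePoly-notFull m i =
  trans (weightPoly-cong m (cong (𝟙 ∘ not) ∘ isFull-shape) i) (weightPoly-notAllTrue m i)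

shapePoly-empty : ∀ m → shapePoly (suc m) isEmpty ≗ const (+ 1)
shapePoly-empty m i =
  trans (weightPoly-cong (suc m) (cong 𝟙 ∘ isEmpty-shape) i) (weightPoly-allFalse (suc m) i)

shapePoly-singleton : ∀ m → shapePoly (suc (suc m)) isSingleton ≗ (+ suc (suc m)) ·ₚ X
shapePoly-singleton m i =
  trans (weightPoly-cong (suc (suc m)) (cong 𝟙 ∘ isSingleton-shape) i) (weightPoly-exactlyOne (suc (suc m)) i)

bothShapes : (Shape → Shape → Bool) → Shape → Shape → Bool
bothShapes r c d = r c d ∧ r d c

mvShapes mixedShapes outerShapes totalShapes : Shape → Shape → Bool
mvShapes    c d = (isEmpty c ∨ isSingleton c) ∨ notFull d
mixedShapes c d = (isFull c ∨ isEmpty c) ∨ notFull d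
outerShapes c d = mvShapes c d ∧ mixedShapes c d
totalShapes _ d = notFull d

bothSides-shape : ∀ {n} {c : Vec Bool n → Vec Bool n → Bool} {r} → (∀ v u → c v u ≡ r (shape v) (shape u)) →
                  ∀ S → bothSides c S ≡ bothShapes r (shape (part {n} true S)) (shape (part {n} false S))
bothSides-shape c≡r S = cong₂ _∧_ (c≡r _ _) (c≡r _ _)

weightPoly-bothSides : ∀ {n} {c : Vec Bool n → Vec Bool n → Bool} r ts →
  (∀ v u → c v u ≡ r (shape v) (shape u)) → (∀ c d → 𝟙 (bothShapes r c d) ≡ termCount ts c d) →
  weightPoly (n ℕ.+ n) (𝟙 ∘ bothSides c) ≗ termPoly n ts
weightPoly-bothSides {n} r ts c≡r r≡ts i =
  trans (weightPoly-cong (n ℕ.+ n) (λ S → trans (cong 𝟙 (bothSides-shape {r = r} c≡r S)) (r≡ts _ _)) i)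
        (weightPoly-termCount n ts i)

module _ {k : ℕ} where

  private
    n : ℕ
    n = suc (suc k)

  mvCondition-shape : ∀ v u → mvCondition {n} v u ≡ mvShapes (shape v) (shape u)
  mvCondition-shape v u =
    cong₂ _∨_ (cong₂ _∨_ (sym (isEmpty-shape v)) (sym (isSingleton-shape v)))
              (cong not (sym (isFull-shape u)))

  outerCondition-shape : ∀ v u → outerCondition {n} v u ≡ outerShapes (shape v) (shape u)
  outerCondition-shape v u =
    cong₂ _∧_ (mvCondition-shape v u)
              (cong₂ _∨_ (cong₂ _∨_ (sym (isFull-shape v)) (sym (isEmpty-shape v)))
                         (cong not (sym (isFull-shape u))))

  totalCondition-shape : ∀ v u → totalCondition {n} v u ≡ totalShapes (shape v) (shape u)
  totalCondition-shape v u = cong not (sym (isFull-shape u))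

mvTerms outerTerms totalTerms : ShapeTerms
mvTerms    = (notFull , notFull) ∷ (isFull , isEmpty) ∷ (isFull , isSingleton)
           ∷ (isEmpty , isFull) ∷ (isSingleton , isFull) ∷ []
outerTerms = (notFull , notFull) ∷ (isFull , isEmpty) ∷ (isEmpty , isFull) ∷ []
totalTerms = (notFull , notFull) ∷ []

mv-terms : ∀ c d → 𝟙 (bothShapes mvShapes c d) ≡ termCount mvTerms c d
mv-terms empty     empty     = refl
mv-terms empty     singleton = refl
mv-terms empty     full      = refl
mv-terms empty     other     = refl
mv-terms singleton empty     = refl
mv-terms singleton singleton = refl
mv-terms singleton full      = refl
mv-terms singleton other     = refl
mv-terms full      empty     = refl
mv-terms full      singleton = refl
mv-terms full      full      = refl
mv-terms full      other     = refl
mv-terms other     empty     = refl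
mv-terms other     singleton = refl
mv-terms other     full      = refl
mv-terms other     other     = refl

outer-terms : ∀ c d → 𝟙 (bothShapes outerShapes c d) ≡ termCount outerTerms c d
outer-terms empty     empty     = refl
outer-terms empty     singleton = refl
outer-terms empty     full      = refl
outer-terms empty     other     = refl
outer-terms singleton empty     = refl
outer-terms singleton singleton = refl
outer-terms singleton full      = refl
outer-terms singleton other     = refl
outer-terms full      empty     = refl
outer-terms full      singleton = refl
outer-terms full      full      = refl
outer-terms full      other     = refl
outer-terms other     empty     = refl
outer-terms other     singleton = refl
outer-terms other     full      = refl
outer-terms other     other     = refl

total-terms : ∀ c d → 𝟙 (bothShapes totalShapes c d) ≡ termCount totalTerms c d
total-terms c d = trans (cong 𝟙 (∧-comm (notFull d) (notFull c))) (sym (ℕₚ.+-identityʳ _))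

X^[m+1] : ∀ m → X ^ₚ (m ℕ.+ 1) ≗ shift (X ^ₚ m)
X^[m+1] m i rewrite ℕₚ.+-comm m 1 = X-*ₚ (X ^ₚ m) i

^ₚ-2 : ∀ p → p ^ₚ 2 ≗ p *ₚ p
^ₚ-2 p = *ₚ-cong {p = p} (λ _ → refl) (*ₚ-identityʳ p)

module _ (k : ℕ) where

  private
    n : ℕ
    n = suc (suc k)
    Q F : Poly
    Q = (X +ₚ const (+ 1)) ^ₚ n -ₚ X ^ₚ n
    F = X ^ₚ n

  notFull*notFull : shapePoly n notFull *ₚ shapePoly n notFull ≗ Q *ₚ Q
  notFull*notFull = *ₚ-cong (shapePoly-notFull n) (shapePoly-notFull n)

  full*empty : shapePoly n isFull *ₚ shapePoly n isEmpty ≗ F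
  full*empty i = trans (*ₚ-cong (shapePoly-full n) (shapePoly-empty (suc k)) i) (*ₚ-identityʳ F i)

  empty*full : shapePoly n isEmpty *ₚ shapePoly n isFull ≗ F
  empty*full i = trans (*ₚ-cong (shapePoly-empty (suc k)) (shapePoly-full n) i) (*ₚ-identityˡ F i)

  full*singleton : shapePoly n isFull *ₚ shapePoly n isSingleton ≗ (+ n) ·ₚ X ^ₚ (n ℕ.+ 1)
  full*singleton i =
    trans (*ₚ-cong (shapePoly-full n) (shapePoly-singleton k) i)
          (trans (*ₚ-·ₚ (+ n) F X i) (cong (+ n ℤ.*_) (trans (*ₚ-X F i) (sym (X^[m+1] n i)))))

  singleton*full : shapePoly n isSingleton *ₚ shapePoly n isFull ≗ (+ n) ·ₚ X ^ₚ (n ℕ.+ 1)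
  singleton*full i =
    trans (*ₚ-cong (shapePoly-singleton k) (shapePoly-full n) i)
          (trans (·ₚ-*ₚ (+ n) X F i) (cong (+ n ℤ.*_) (trans (X-*ₚ F i) (sym (X^[m+1] n i)))))

  termPoly-mv : termPoly n mvTerms ≗ Q ^ₚ 2 +ₚ const (+ (2 ℕ.* n)) *ₚ X ^ₚ (n ℕ.+ 1) +ₚ const (+ 2) *ₚ X ^ₚ n
  termPoly-mv i =
    begin
      termPoly n mvTerms i
    ≡⟨ cong₂ ℤ._+_ (notFull*notFull i)
         (cong₂ ℤ._+_ (full*empty i) (cong₂ ℤ._+_ (full*singleton i)
           (cong₂ ℤ._+_ (empty*full i) (cong₂ ℤ._+_ (singleton*full i) refl)))) ⟩
      (Q *ₚ Q) i ℤ.+ (F i ℤ.+ (+ n ℤ.* G i ℤ.+ (F i ℤ.+ (+ n ℤ.* G i ℤ.+ + 0))))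
    ≡⟨ collect ((Q *ₚ Q) i) (F i) (G i) (+ n) ⟩
      (Q *ₚ Q) i ℤ.+ (+ 2 ℤ.* + n) ℤ.* G i ℤ.+ + 2 ℤ.* F i
    ≡⟨ cong₂ ℤ._+_ (cong₂ ℤ._+_ (^ₚ-2 Q i)
                                (trans (const-*ₚ (+ (2 ℕ.* n)) G i) (cong (ℤ._* G i) (ℤₚ.pos-* 2 n))))
                   (const-*ₚ (+ 2) F i) ⟨
      (Q ^ₚ 2 +ₚ const (+ (2 ℕ.* n)) *ₚ X ^ₚ (n ℕ.+ 1) +ₚ const (+ 2) *ₚ X ^ₚ n) i
    ∎
    where
    open ≡-Reasoning
    G : Poly
    G = X ^ₚ (n ℕ.+ 1)
    collect : ∀ q f g m → q ℤ.+ (f ℤ.+ (m ℤ.* g ℤ.+ (f ℤ.+ (m ℤ.* g ℤ.+ + 0))))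
                          ≡ q ℤ.+ (+ 2 ℤ.* m) ℤ.* g ℤ.+ + 2 ℤ.* f
    collect = solve-∀

  termPoly-outer : termPoly n outerTerms ≗ Q ^ₚ 2 +ₚ const (+ 2) *ₚ X ^ₚ n
  termPoly-outer i =
    begin
      termPoly n outerTerms i
    ≡⟨ cong₂ ℤ._+_ (notFull*notFull i) (cong₂ ℤ._+_ (full*empty i) (cong₂ ℤ._+_ (empty*full i) refl)) ⟩
      (Q *ₚ Q) i ℤ.+ (F i ℤ.+ (F i ℤ.+ + 0))
    ≡⟨ collect ((Q *ₚ Q) i) (F i) ⟩
      (Q *ₚ Q) i ℤ.+ + 2 ℤ.* F i
    ≡⟨ cong₂ ℤ._+_ (^ₚ-2 Q i) (const-*ₚ (+ 2) F i) ⟨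
      (Q ^ₚ 2 +ₚ const (+ 2) *ₚ X ^ₚ n) i
    ∎
    where
    open ≡-Reasoning
    collect : ∀ q f → q ℤ.+ (f ℤ.+ (f ℤ.+ + 0)) ≡ q ℤ.+ + 2 ℤ.* f
    collect = solve-∀

  termPoly-total : termPoly n totalTerms ≗ Q ^ₚ 2
  termPoly-total i = trans (trans (cong (ℤ._+ + 0) (notFull*notFull i)) (ℤₚ.+-identityʳ _)) (sym (^ₚ-2 Q i))

countingPolyIs-onEachSide : ∀ n {P : Subset (n ℕ.+ n) → Set} {p} (c : Vec Bool n → Vec Bool n → Bool) →
                            (∀ S → P S ⇔ OnEachSide c S) →
                            weightPoly (n ℕ.+ n) (𝟙 ∘ bothSides c) ≗ p → CountingPolyIs (K n) P p
countingPolyIs-onEachSide n c P⇔ =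
  countingPolyIs (K n) (bothSides c) λ S → ⇔.trans (P⇔ S) (⇔.sym (bothSides⇔ c S))

mutualVisibilityPoly : ∀ n → 2 ≤ n → weightPoly (n ℕ.+ n) (𝟙 ∘ bothSides {n} mvCondition) ≗
  ((X +ₚ const (+ 1)) ^ₚ n -ₚ X ^ₚ n) ^ₚ 2 +ₚ const (+ (2 ℕ.* n)) *ₚ X ^ₚ (n ℕ.+ 1) +ₚ const (+ 2) *ₚ X ^ₚ n
mutualVisibilityPoly (suc (suc k)) (s≤s (s≤s z≤n)) i =
  trans (weightPoly-bothSides mvShapes mvTerms (mvCondition-shape {k}) mv-terms i)
        (termPoly-mv k i)

outerMutualVisibilityPoly : ∀ n → 2 ≤ n → weightPoly (n ℕ.+ n) (𝟙 ∘ bothSides {n} outerCondition) ≗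
  ((X +ₚ const (+ 1)) ^ₚ n -ₚ X ^ₚ n) ^ₚ 2 +ₚ const (+ 2) *ₚ X ^ₚ n
outerMutualVisibilityPoly (suc (suc k)) (s≤s (s≤s z≤n)) i =
  trans (weightPoly-bothSides outerShapes outerTerms (outerCondition-shape {k}) outer-terms i)
        (termPoly-outer k i)

totalMutualVisibilityPoly : ∀ n → 2 ≤ n → weightPoly (n ℕ.+ n) (𝟙 ∘ bothSides {n} totalCondition) ≗
  ((X +ₚ const (+ 1)) ^ₚ n -ₚ X ^ₚ n) ^ₚ 2
totalMutualVisibilityPoly (suc (suc k)) (s≤s (s≤s z≤n)) i =
  trans (weightPoly-bothSides totalShapes totalTerms (totalCondition-shape {k}) total-terms i)
        (termPoly-total k i)

proposition3p2 : ∀ (n : ℕ) → 3 ≤ n →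
    CountingPolyIs (K n) (IsMutualVisibility (K n))
      (((X +ₚ const (+ 1)) ^ₚ n -ₚ X ^ₚ n) ^ₚ 2
        +ₚ const (+ (2 ℕ.* n)) *ₚ X ^ₚ (n ℕ.+ 1) +ₚ const (+ 2) *ₚ X ^ₚ n)
    × CountingPolyIs (K n) (IsOuterMutualVisibility (K n))
      (((X +ₚ const (+ 1)) ^ₚ n -ₚ X ^ₚ n) ^ₚ 2 +ₚ const (+ 2) *ₚ X ^ₚ n)
    × CountingPolyIs (K n) (IsDualMutualVisibility (K n))
      (((X +ₚ const (+ 1)) ^ₚ n -ₚ X ^ₚ n) ^ₚ 2)
    × CountingPolyIs (K n) (IsTotalMutualVisibility (K n))
      (((X +ₚ const (+ 1)) ^ₚ n -ₚ X ^ₚ n) ^ₚ 2)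
proposition3p2 n 3≤n =
  countingPolyIs-onEachSide n mvCondition (mutualVisibility⇔ {n})
                            (mutualVisibilityPoly n 2≤n) ,
  countingPolyIs-onEachSide n outerCondition (outerMutualVisibility⇔ {n})
                            (outerMutualVisibilityPoly n 2≤n) ,
  countingPolyIs-onEachSide n totalCondition (dualMutualVisibility⇔ {n} 3≤n)
                            (totalMutualVisibilityPoly n 2≤n) ,
  countingPolyIs-onEachSide n totalCondition (totalMutualVisibility⇔ {n} 2≤n)
                            (totalMutualVisibilityPoly n 2≤n)
  where
  2≤n : 2 ≤ n
  2≤n = ℕₚ.<⇒≤ 3≤n
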